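{- Let $n \in \mathbb{N}$ and let $\mathcal{F} \subseteq \mathcal{P}([n])$ be a union closed family with $\emptyset \in \mathcal{F}$. Define $\tau: \mathcal{P}([n]) \to \mathcal{P}([n])$ by $\tau(X) = \bigcup\{F \in \mathcal{F} : F \subseteq X\}$, and for $F \in \mathcal{F}$ let $\mathcal{T}(F) = \tau^{ -1}(F) = \{X \subseteq [n] : \tau(X) = F\}$. If $E, F \in \mathcal{F}$ with $E \subseteq F$, then $\#\mathcal{T}(F) \leq \#\mathcal{T}(E)$.
   Context: $[n] = \{1,\dots,n\}$, $\mathcal{P}([n])$ its power set, $\#X$ the cardinality. A family is union closed if $A, B \in \mathcal{F}$ implies $A \cup B \in \mathcal{F}$. -}

module Defs where

open import Data.Nat using (ℕ; zero; suc)
open import Data.Bool using (Bool; true; false)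
open import Data.List using (List; []; _∷_; _++_; map; filter; foldr; length)
open import Data.Vec using (Vec; []; _∷_)
open import Data.Fin.Subset using (Subset; _∪_; _⊆_; ⊥; inside; outside)
open import Data.Fin.Subset.Properties using (_⊆?_)
open import Data.Product using (_×_)
open import Relation.Nullary using (Dec)
open import Relation.Nullary.Decidable using (_×-dec_)
open import Relation.Unary using (Pred; Decidable)
open import Relation.Binary.PropositionalEquality using (_≡_)
open import Level using (0ℓ)

-- A family 𝓕 ⊆ 𝓟([n]) is given as a decidable predicate on subsets of [n]
-- (Subset n = Vec Bool n, i.e. subsets of Fin n ≅ [n]).
Family : ℕ → Set₁
Family n = Pred (Subset n) 0ℓ

-- Explicit enumeration of 𝓟([n]) (each subset exactly once).
allSubsets : (n : ℕ) → List (Subset n)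
allSubsets zero = [] ∷ []
allSubsets (suc n) = map (outside ∷_) (allSubsets n) ++ map (inside ∷_) (allSubsets n)

UnionClosed : ∀ {n} → Family n → Set
UnionClosed {n} 𝓕 = ∀ (A B : Subset n) → 𝓕 A → 𝓕 B → 𝓕 (A ∪ B)

τ : ∀ {n} (𝓕 : Family n) → Decidable 𝓕 → Subset n → Subset n
τ {n} 𝓕 𝓕? X =
  foldr _∪_ ⊥ (filter (λ S → 𝓕? S ×-dec (S ⊆? X)) (allSubsets n))

#𝓣 : ∀ {n} (𝓕 : Family n) → Decidable 𝓕 → Subset n → ℕ
#𝓣 {n} 𝓕 𝓕? F =
  length (filter (λ X → ≡-decS (τ 𝓕 𝓕? X) F) (allSubsets n))
  where
  open import Data.Vec.Properties using (≡-dec)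
  open import Data.Bool.Properties using (_≟_)
  ≡-decS = ≡-dec _≟_

-- Every X with τ(X) = F contains F, since τ(X) ⊆ X. Put D = F ∖ E and map X to X ∖ D.
-- The members of 𝓕 below X lie below τ(X) = F, so those below X ∖ D lie below E,
-- while E itself lies below X ∖ D; hence τ(X ∖ D) = E. As D ⊆ X, the map is
-- injective, so it embeds 𝓣(F) into 𝓣(E).
module Submission where

open import Defs
open import Data.Nat using (ℕ; zero; suc; _≤_; _+_; z≤n)
open import Data.Nat.Properties using (≤-refl; m≤m+n; +-mono-≤; module ≤-Reasoning)
open import Data.Fin using (Fin)
open import Data.Fin.Subset using (Subset; _⊆_; ⊥; _─_; ⋃; inside; outside; _∈_; _∉_)
open import Data.Fin.Subset.Properties
  using (_⊆?_; _∈?_; drop-∷-⊆; p─q⊆p; x∈p∧x∉q⇒x∈p─q; ⊆-antisym; p⊆p∪q; q⊆p∪q; x∈p∪q⁻; ∉⊥)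
open import Data.Vec using ([]; _∷_; here; there)
open import Data.List using (List; []; _∷_; _++_; map; filter; length)
open import Data.List.Properties using (length-++; length-map; filter-++; filter-none)
open import Data.List.Relation.Unary.All as All using (All; []; _∷_)
open import Data.List.Relation.Unary.All.Properties using (all-filter)
open import Data.List.Relation.Unary.Any using (here; there)
import Data.List.Membership.Propositional as List
open import Data.List.Membership.Propositional.Properties using (∈-filter⁺; ∈-map⁺; ∈-++⁺ˡ; ∈-++⁺ʳ)
open import Data.Product using (_×_; _,_; proj₁; proj₂)
open import Data.Sum using (inj₁; inj₂)
open import Data.Empty using (⊥-elim)
open import Function using (_∘_)
open import Relation.Nullary using (yes; no; ¬_)
open import Relation.Nullary.Decidable using (_×-dec_; decidable-stable)
open import Relation.Unary using (Pred; Decidable)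
open import Relation.Binary.PropositionalEquality using (_≡_; refl; cong; cong₂; subst; module ≡-Reasoning)
open import Level using (0ℓ)

filter-map : ∀ {A B : Set} {P : Pred B 0ℓ} (P? : Decidable P) (f : A → B) (xs : List A) →
             filter P? (map f xs) ≡ map f (filter (P? ∘ f) xs)
filter-map P? f [] = refl
filter-map P? f (x ∷ xs) with P? (f x)
... | yes _ = cong (f x ∷_) (filter-map P? f xs)
... | no _  = filter-map P? f xs

length-filter-map : ∀ {A B : Set} {P : Pred B 0ℓ} (P? : Decidable P) (f : A → B) (xs : List A) →
                    length (filter P? (map f xs)) ≡ length (filter (P? ∘ f) xs)
length-filter-map P? f xs = begin
  length (filter P? (map f xs))        ≡⟨ cong length (filter-map P? f xs) ⟩
  length (map f (filter (P? ∘ f) xs))  ≡⟨ length-map f (filter (P? ∘ f) xs) ⟩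
  length (filter (P? ∘ f) xs)          ∎
  where open ≡-Reasoning

x∈p─q⇒x∉q : ∀ {n} (p q : Subset n) {x : Fin n} → x ∈ p ─ q → x ∉ q
x∈p─q⇒x∉q (s ∷ p) (inside ∷ q) () here
x∈p─q⇒x∉q (s ∷ p) (t ∷ q) (there x∈p─q) (there x∈q) = x∈p─q⇒x∉q p q x∈p─q x∈q

x∈p∧x∉p─q⇒x∈q : ∀ {n} {p q : Subset n} {x : Fin n} → x ∈ p → x ∉ p ─ q → x ∈ q
x∈p∧x∉p─q⇒x∈q {q = q} {x} x∈p x∉p─q =
  decidable-stable (x ∈? q) (λ x∉q → x∉p─q (x∈p∧x∉q⇒x∈p─q x∈p x∉q))

⋃-least : ∀ {n} {B : Subset n} (xs : List (Subset n)) → All (_⊆ B) xs → ⋃ xs ⊆ B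
⋃-least []       []           x∈⋃ = ⊥-elim (∉⊥ x∈⋃)
⋃-least (S ∷ xs) (S⊆B ∷ xs⊆B) x∈⋃ with x∈p∪q⁻ S (⋃ xs) x∈⋃
... | inj₁ x∈S   = S⊆B x∈S
... | inj₂ x∈⋃xs = ⋃-least xs xs⊆B x∈⋃xs

⊆-⋃ : ∀ {n} {S : Subset n} (xs : List (Subset n)) → S List.∈ xs → S ⊆ ⋃ xs
⊆-⋃ (S ∷ xs) (here refl) = p⊆p∪q (⋃ xs)
⊆-⋃ (T ∷ xs) (there S∈xs) = q⊆p∪q T (⋃ xs) ∘ ⊆-⋃ xs S∈xs

∈-allSubsets : ∀ {n} (S : Subset n) → S List.∈ allSubsets n
∈-allSubsets []            = here refl
∈-allSubsets (outside ∷ S) = ∈-++⁺ˡ (∈-map⁺ (outside ∷_) (∈-allSubsets S))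
∈-allSubsets {suc n} (inside ∷ S) =
  ∈-++⁺ʳ (map (outside ∷_) (allSubsets n)) (∈-map⁺ (inside ∷_) (∈-allSubsets S))

countSubsets : ∀ {n} {P : Pred (Subset n) 0ℓ} → Decidable P → ℕ
countSubsets {n} P? = length (filter P? (allSubsets n))

countSubsets-suc : ∀ {n} {P : Pred (Subset (suc n)) 0ℓ} (P? : Decidable P) →
                   countSubsets P? ≡ countSubsets (P? ∘ (outside ∷_)) + countSubsets (P? ∘ (inside ∷_))
countSubsets-suc {n} P? = begin
  length (filter P? (outsides ++ insides))
    ≡⟨ cong length (filter-++ P? outsides insides) ⟩
  length (filter P? outsides ++ filter P? insides)
    ≡⟨ length-++ (filter P? outsides) ⟩
  length (filter P? outsides) + length (filter P? insides)
    ≡⟨ cong₂ _+_ (length-filter-map P? (outside ∷_) (allSubsets n))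
                 (length-filter-map P? (inside ∷_) (allSubsets n)) ⟩
  countSubsets (P? ∘ (outside ∷_)) + countSubsets (P? ∘ (inside ∷_)) ∎
  where
  open ≡-Reasoning
  outsides = map (outside ∷_) (allSubsets n)
  insides  = map (inside ∷_) (allSubsets n)

countSubsets-none : ∀ {n} {P : Pred (Subset n) 0ℓ} (P? : Decidable P) →
                    (∀ X → ¬ P X) → countSubsets P? ≡ 0
countSubsets-none {n} P? ¬P = cong length (filter-none P? (All.universal ¬P (allSubsets n)))

removing-tail : ∀ {n} {b c} {D : Subset n} {P Q : Pred (Subset n) 0ℓ} →
                (∀ X → P X → b ∷ D ⊆ c ∷ X × Q (X ─ D)) → ∀ X → P X → D ⊆ X × Q (X ─ D)
removing-tail h X p = drop-∷-⊆ (proj₁ (h X p)) , proj₂ (h X p)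

-- X ↦ X ─ D is injective on the sets containing D; where D is inside, P holds of no set
-- that is outside there, so that half of the count vanishes.
countSubsets-≤-by-removing :
  ∀ {n} {P Q : Pred (Subset n) 0ℓ} (P? : Decidable P) (Q? : Decidable Q) (D : Subset n) →
  (∀ X → P X → D ⊆ X × Q (X ─ D)) → countSubsets P? ≤ countSubsets Q?
countSubsets-≤-by-removing {zero} P? Q? [] h with P? []
... | no _  = z≤n
... | yes p with Q? []
...   | yes _ = ≤-refl
...   | no ¬q = ⊥-elim (¬q (proj₂ (h [] p)))
countSubsets-≤-by-removing {suc n} {Q = Q} P? Q? (outside ∷ D) h = begin
  countSubsets P?
    ≡⟨ countSubsets-suc P? ⟩
  countSubsets (P? ∘ (outside ∷_)) + countSubsets (P? ∘ (inside ∷_))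
    ≤⟨ +-mono-≤ (countSubsets-≤-by-removing (P? ∘ (outside ∷_)) (Q? ∘ (outside ∷_)) D
                  (removing-tail {Q = Q ∘ (outside ∷_)} (h ∘ (outside ∷_))))
                (countSubsets-≤-by-removing (P? ∘ (inside ∷_)) (Q? ∘ (inside ∷_)) D
                  (removing-tail {Q = Q ∘ (inside ∷_)} (h ∘ (inside ∷_)))) ⟩
  countSubsets (Q? ∘ (outside ∷_)) + countSubsets (Q? ∘ (inside ∷_))
    ≡⟨ countSubsets-suc Q? ⟨
  countSubsets Q? ∎
  where open ≤-Reasoning
countSubsets-≤-by-removing {suc n} {Q = Q} P? Q? (inside ∷ D) h = begin
  countSubsets P?
    ≡⟨ countSubsets-suc P? ⟩
  countSubsets (P? ∘ (outside ∷_)) + countSubsets (P? ∘ (inside ∷_))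
    ≡⟨ cong (_+ countSubsets (P? ∘ (inside ∷_)))
            (countSubsets-none (P? ∘ (outside ∷_)) (λ X p → outside∌zero (proj₁ (h _ p) here))) ⟩
  countSubsets (P? ∘ (inside ∷_))
    ≤⟨ countSubsets-≤-by-removing (P? ∘ (inside ∷_)) (Q? ∘ (outside ∷_)) D
         (removing-tail {Q = Q ∘ (outside ∷_)} (h ∘ (inside ∷_))) ⟩
  countSubsets (Q? ∘ (outside ∷_))
    ≤⟨ m≤m+n _ _ ⟩
  countSubsets (Q? ∘ (outside ∷_)) + countSubsets (Q? ∘ (inside ∷_))
    ≡⟨ countSubsets-suc Q? ⟨
  countSubsets Q? ∎
  where
  open ≤-Reasoning
  outside∌zero : ∀ {X : Subset n} → ¬ (Fin.zero ∈ outside ∷ X)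
  outside∌zero ()

module _ {n : ℕ} (𝓕 : Family n) (𝓕? : Decidable 𝓕) where

  τ-least : ∀ {X B : Subset n} → (∀ G → 𝓕 G → G ⊆ X → G ⊆ B) → τ 𝓕 𝓕? X ⊆ B
  τ-least {X} below⇒⊆B = ⋃-least _
    (All.map (λ (𝓕G , G⊆X) {x} → below⇒⊆B _ 𝓕G G⊆X {x})
             (all-filter (λ S → 𝓕? S ×-dec (S ⊆? X)) (allSubsets n)))

  ⊆-τ : ∀ {X G : Subset n} → 𝓕 G → G ⊆ X → G ⊆ τ 𝓕 𝓕? X
  ⊆-τ {X} {G} 𝓕G G⊆X = ⊆-⋃ _ (∈-filter⁺ (λ S → 𝓕? S ×-dec (S ⊆? X)) (∈-allSubsets G) (𝓕G , G⊆X))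

  τ-⊆ : ∀ (X : Subset n) → τ 𝓕 𝓕? X ⊆ X
  τ-⊆ X = τ-least (λ _ _ G⊆X → G⊆X)

  τ≡⇒⊆ : ∀ {X F : Subset n} → τ 𝓕 𝓕? X ≡ F → F ⊆ X
  τ≡⇒⊆ {X} τX≡F = subst (_⊆ X) τX≡F (τ-⊆ X)

  τ-─ : ∀ {X E F : Subset n} → τ 𝓕 𝓕? X ≡ F → 𝓕 E → E ⊆ F → τ 𝓕 𝓕? (X ─ (F ─ E)) ≡ E
  τ-─ {X} {E} {F} τX≡F 𝓕E E⊆F = ⊆-antisym (τ-least below⇒⊆E) (⊆-τ 𝓕E E⊆X─D)
    where
    below⇒⊆E : ∀ G → 𝓕 G → G ⊆ X ─ (F ─ E) → G ⊆ E
    below⇒⊆E G 𝓕G G⊆X─D x∈G = x∈p∧x∉p─q⇒x∈q x∈F (x∈p─q⇒x∉q X (F ─ E) (G⊆X─D x∈G))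
      where
      x∈F = subst (_ ∈_) τX≡F (⊆-τ 𝓕G (p─q⊆p X (F ─ E) ∘ G⊆X─D) x∈G)

    E⊆X─D : E ⊆ X ─ (F ─ E)
    E⊆X─D x∈E = x∈p∧x∉q⇒x∈p─q (τ≡⇒⊆ τX≡F (E⊆F x∈E)) (λ x∈D → x∈p─q⇒x∉q F E x∈D x∈E)

lemma3p5 : (n : ℕ) (𝓕 : Family n) (𝓕? : Decidable 𝓕) →
    UnionClosed 𝓕 → 𝓕 ⊥ →
    (E F : Subset n) → 𝓕 E → 𝓕 F → E ⊆ F →
    #𝓣 𝓕 𝓕? F ≤ #𝓣 𝓕 𝓕? E
lemma3p5 n 𝓕 𝓕? _ _ E F 𝓕E _ E⊆F =
  countSubsets-≤-by-removing _ _ (F ─ E) λ X τX≡F →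
    τ≡⇒⊆ 𝓕 𝓕? τX≡F ∘ p─q⊆p F E , τ-─ 𝓕 𝓕? τX≡F 𝓕E E⊆F
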